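{- Let $c,k\geq 2$ be integers, let $H$ be a graph and $P$ a path such that every $(c-1)$-colouring of $H$ has clustering at least $k$, and every $c$-colouring of $H\boxtimes P$ has clustering at least $k$. Let $J:=\widehat{(k-1)\,H}$. Then every $(c+1)$-colouring of $J\boxtimes P$ has clustering at least $k$.
   Context: All graphs are finite and simple. For a positive integer $m$ and a graph $G$, $\widehat{m\,G}$ denotes the graph obtained from $m$ pairwise disjoint copies of $G$ by adding one new vertex adjacent to all vertices of all copies. A colouring of a graph assigns a colour to each vertex (adjacent vertices may receive the same colour); a $c$-colouring uses at most $c$ colours. A monochromatic component is a connected component of the subgraph induced by the vertices of one colour. "Every colouring has clustering at least $k$" means every such colouring has a monochromatic component with at least $k$ vertices. The strong product $G\boxtimes H$ has vertex set $V(G)\times V(H)$, with distinct $(u,v),(u',v')$ adjacent iff ($u=u'$ and $vv'\in E(H)$) or ($v=v'$ and $uu'\in E(G)$) or ($uu'\in E(G)$ and $vv'\in E(H)$). -}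

module Defs where

open import Data.Nat using (ℕ; suc; _≥_)
open import Data.Fin using (Fin; toℕ)
open import Data.Maybe using (Maybe; just; nothing)
open import Data.Product using (Σ; _×_; _,_; ∃)
open import Data.Sum using (_⊎_)
open import Data.Unit using (⊤)
open import Data.Empty using (⊥)
open import Relation.Nullary using (¬_)
open import Relation.Binary.PropositionalEquality using (_≡_)
open import Function.Bundles using (_↔_)
open import Function.Definitions using (Injective)

record Graph : Set₁ where
  field
    V   : Set
    Adj : V → V → Set
open Graph public

Finite : Graph → Set
Finite G = Σ ℕ λ n → V G ↔ Fin n

IsSimple : Graph → Set
IsSimple G = (∀ {u v} → Adj G u v → Adj G v u) × (∀ {v} → ¬ Adj G v v)

FiniteSimple : Graph → Set
FiniteSimple G = Finite G × IsSimple G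

PathGraph : ℕ → Graph
PathGraph m = record
  { V = Fin m
  ; Adj = λ i j → (suc (toℕ i) ≡ toℕ j) ⊎ (suc (toℕ j) ≡ toℕ i) }

_⊠_ : Graph → Graph → Graph
G ⊠ H = record
  { V = V G × V H
  ; Adj = λ { (u , v) (u' , v') →
        (u ≡ u' × Adj H v v') ⊎ ((v ≡ v' × Adj G u u') ⊎ (Adj G u u' × Adj H v v')) } }

-- hat(m G): m disjoint copies of G plus a new vertex (nothing) adjacent to all.
hatAdj : (m : ℕ) (G : Graph) → Maybe (Fin m × V G) → Maybe (Fin m × V G) → Set
hatAdj m G nothing nothing = ⊥
hatAdj m G nothing (just _) = ⊤
hatAdj m G (just _) nothing = ⊤
hatAdj m G (just (i , x)) (just (j , y)) = i ≡ j × Adj G x y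

hat : ℕ → Graph → Graph
hat m G = record { V = Maybe (Fin m × V G) ; Adj = hatAdj m G }

Colouring : Graph → ℕ → Set
Colouring G c = V G → Fin c

data MonoReach {c : ℕ} (G : Graph) (χ : Colouring G c) : V G → V G → Set where
  here : ∀ {v} → MonoReach G χ v v
  step : ∀ {u w x} → Adj G u w → χ u ≡ χ w → MonoReach G χ w x → MonoReach G χ u x

HasMonoComponent≥ : {c : ℕ} (G : Graph) (χ : Colouring G c) (k : ℕ) → Set
HasMonoComponent≥ G χ k =
  Σ (V G) λ v → Σ (Fin k → V G) λ f → Injective _≡_ _≡_ f × (∀ i → MonoReach G χ v (f i))

ClusteringAtLeast : Graph → ℕ → ℕ → Set
ClusteringAtLeast G c k = (χ : Colouring G c) → HasMonoComponent≥ G χ k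

-- Look at the column of apex vertices of J ⊠ P.  If it is monochromatic, of colour a,
-- then either some copy of H ⊠ P avoids a, so that only c colours are left on it, or
-- every copy has an a-coloured vertex; such a vertex is adjacent to the apex in its own
-- layer, so these k - 1 vertices lie in the component of the column.  Otherwise two
-- consecutive apex vertices u, u' have distinct colours a, b.  Either some layer of a
-- copy of H next to them avoids both a and b, leaving c - 1 colours, or each of those
-- 2(k - 1) layers has a vertex coloured a or b; all these vertices are adjacent to both
-- u and u', so by pigeonhole k - 1 of them join the component of u or of u'.
-- Finiteness of H is only used to decide whether a colour occurs in a copy or a layer.
module Submission where

open import Defs
open import Data.Nat using (ℕ; zero; suc; _+_; _∸_; _≥_)
open import Data.Nat.Properties using (+-suc; 1+n≢n)
open import Data.Fin using (Fin; zero; suc; inject₁; punchOut; _≟_)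
open import Data.Fin.Properties
  using (suc-injective; 0≢1+n; toℕ-inject₁; punchOut-injective; any?; all?; ¬∀⟶∃¬)
open import Data.Maybe using (nothing; just)
open import Data.Maybe.Properties using (just-injective)
open import Data.Product using (Σ; ∃; _×_; _,_; proj₁; proj₂)
open import Data.Product.Properties using (,-injectiveˡ; ,-injectiveʳ)
open import Data.Sum using (_⊎_; inj₁; inj₂; [_,_]′; swap)
import Data.Sum as Sum
open import Data.Unit using (tt)
open import Function using (_∘_; id; _↔_; Inverse)
open import Function.Definitions using (Injective)
open import Relation.Nullary using (¬_; Dec; yes; no; contradiction)
open import Relation.Nullary.Decidable using (map′; _⊎-dec_)
open import Relation.Unary using (Decidable)
open import Relation.Binary.PropositionalEquality
  using (_≡_; _≢_; refl; sym; trans; cong; cong₂; subst; ≢-sym)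

private
  variable
    X Y : Set
    P Q : X → Set
    c c' k n m : ℕ
    G G' G'' L : Graph

record AtLeast {X : Set} (k : ℕ) (P : X → Set) : Set where
  constructor distinct
  field
    elem : Fin k → X
    elem-injective : Injective _≡_ _≡_ elem
    elem-satisfies : ∀ i → P (elem i)

atLeast-zero : AtLeast 0 P
atLeast-zero = distinct (λ ()) (λ { {()} }) (λ ())

atLeast-map : (f : X → Y) → Injective _≡_ _≡_ f → (∀ {x} → P x → Q (f x)) →
  AtLeast k P → AtLeast k Q
atLeast-map f f-inj P⇒Q (distinct g g-inj Pg) =
  distinct (f ∘ g) (λ e → g-inj (f-inj e)) (λ i → P⇒Q (Pg i))

atLeast-mono : (∀ {x} → P x → Q x) → AtLeast k P → AtLeast k Q
atLeast-mono = atLeast-map id id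

atLeast-cons : ∀ {x} → P x → AtLeast k (λ y → P y × y ≢ x) → AtLeast (suc k) P
atLeast-cons {P = P} {k = k} {x = x} px (distinct f f-inj Pf) = distinct g g-inj Pg
  where
  g : Fin (suc k) → _
  g zero = x
  g (suc i) = f i

  g-inj : Injective _≡_ _≡_ g
  g-inj {zero} {zero} _ = refl
  g-inj {zero} {suc j} e = contradiction (sym e) (proj₂ (Pf j))
  g-inj {suc i} {zero} e = contradiction e (proj₂ (Pf i))
  g-inj {suc i} {suc j} e = cong suc (f-inj e)

  Pg : ∀ i → P (g i)
  Pg zero = px
  Pg (suc i) = proj₁ (Pf i)

atLeast-uncons : AtLeast (suc k) P → Σ X λ x → P x × AtLeast k (λ y → P y × y ≢ x)
atLeast-uncons (distinct f f-inj Pf) =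
  f zero , Pf zero ,
  distinct (f ∘ suc) (λ e → suc-injective (f-inj e))
    (λ i → Pf (suc i) , λ e → 0≢1+n (f-inj (sym e)))

atLeast-⊎ : ∀ {p q} → (∀ {x} → P x → ¬ Q x) →
  AtLeast p P → AtLeast q Q → AtLeast (p + q) (λ x → P x ⊎ Q x)
atLeast-⊎ {p = zero} _ _ Qs = atLeast-mono inj₂ Qs
atLeast-⊎ {P = P} {Q = Q} {p = suc p} disjoint Ps Qs with atLeast-uncons Ps
... | x , px , Ps′ =
  atLeast-cons (inj₁ px) (atLeast-mono tag (atLeast-⊎ (disjoint ∘ proj₁) Ps′ Qs))
  where
  tag : ∀ {y} → (P y × y ≢ x) ⊎ Q y → (P y ⊎ Q y) × y ≢ x
  tag (inj₁ (py , y≢x)) = inj₁ py , y≢x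
  tag (inj₂ qy) = inj₂ qy , λ { refl → disjoint px qy }

pigeonhole-⊎ : ∀ p q → AtLeast (p + q) (λ x → P x ⊎ Q x) → AtLeast p P ⊎ AtLeast q Q
pigeonhole-⊎ zero q _ = inj₁ atLeast-zero
pigeonhole-⊎ (suc p) zero _ = inj₂ atLeast-zero
pigeonhole-⊎ {P = P} {Q = Q} (suc p) (suc q) xs with atLeast-uncons {P = λ y → P y ⊎ Q y} xs
... | x , inj₁ px , rest =
  Sum.map₁ (atLeast-cons px) (pigeonhole-⊎ p (suc q) (atLeast-mono tagP rest))
  where
  tagP : ∀ {y} → (P y ⊎ Q y) × y ≢ x → (P y × y ≢ x) ⊎ Q y
  tagP (inj₁ py , y≢x) = inj₁ (py , y≢x)
  tagP (inj₂ qy , _) = inj₂ qy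
... | x , inj₂ qx , rest =
  Sum.map₂ (atLeast-cons qx)
    (pigeonhole-⊎ (suc p) q
      (subst (λ n → AtLeast n (λ y → P y ⊎ (Q y × y ≢ x))) (+-suc p q)
        (atLeast-mono tagQ rest)))
  where
  tagQ : ∀ {y} → (P y ⊎ Q y) × y ≢ x → P y ⊎ (Q y × y ≢ x)
  tagQ (inj₁ py , _) = inj₁ py
  tagQ (inj₂ qy , y≢x) = inj₂ (qy , y≢x)

any?-↔ : {P : X → Set} → X ↔ Fin n → Decidable P → Dec (∃ P)
any?-↔ {P = P} X↔Fin P? =
  map′ (λ (j , p) → from j , p) (λ (x , p) → to x , subst P (sym (strictlyInverseʳ x)) p)
    (any? (P? ∘ from))
  where open Inverse X↔Fin

all-or-counterexample : {P : Fin n → Set} → Decidable P → (∀ i → P i) ⊎ ∃ λ i → ¬ P i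
all-or-counterexample P? with all? P?
... | yes all = inj₁ all
... | no ¬all = inj₂ (¬∀⟶∃¬ _ _ P? ¬all)

reach-trans : {χ : Colouring G c} {u v w : V G} →
  MonoReach G χ u v → MonoReach G χ v w → MonoReach G χ u w
reach-trans here r = r
reach-trans (step a e r) r′ = step a e (reach-trans r r′)

reach-colour : {χ : Colouring G c} {u v : V G} → MonoReach G χ u v → χ u ≡ χ v
reach-colour here = refl
reach-colour (step _ e r) = trans e (reach-colour r)

infix 4 _↪_

record _↪_ (G G' : Graph) : Set where
  field
    embed : V G → V G'
    embed-adj : ∀ {u v} → Adj G u v → Adj G' (embed u) (embed v)
    embed-injective : Injective _≡_ _≡_ embed
open _↪_

↪-refl : G ↪ G
↪-refl = record { embed = id ; embed-adj = id ; embed-injective = id }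

_∘↪_ : G' ↪ G'' → G ↪ G' → G ↪ G''
f ∘↪ g = record
  { embed = embed f ∘ embed g
  ; embed-adj = embed-adj f ∘ embed-adj g
  ; embed-injective = λ e → embed-injective g (embed-injective f e) }

reach-embed : (e : G ↪ G') {ψ : Colouring G c} {χ : Colouring G' c'} →
  (∀ {u v} → ψ u ≡ ψ v → χ (embed e u) ≡ χ (embed e v)) →
  ∀ {u v} → MonoReach G ψ u v → MonoReach G' χ (embed e u) (embed e v)
reach-embed e compat here = here
reach-embed e compat (step a eq r) = step (embed-adj e a) (compat eq) (reach-embed e compat r)

mono-component : {χ : Colouring G c} (u : V G) →
  AtLeast k (MonoReach G χ u) → HasMonoComponent≥ G χ k
mono-component u (distinct f f-inj r) = u , f , f-inj , r

component-embed : (e : G ↪ G') {ψ : Colouring G c} {χ : Colouring G' c'} →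
  (∀ {u v} → ψ u ≡ ψ v → χ (embed e u) ≡ χ (embed e v)) →
  HasMonoComponent≥ G ψ k → HasMonoComponent≥ G' χ k
component-embed e compat (v , f , f-inj , r) =
  mono-component (embed e v)
    (atLeast-map (embed e) (embed-injective e) (reach-embed e compat) (distinct f f-inj r))

dropColour : (χ : X → Fin (suc c)) {a : Fin (suc c)} → (∀ v → χ v ≢ a) → X → Fin c
dropColour χ avoids v = punchOut (≢-sym (avoids v))

dropColour-reflects : (χ : X → Fin (suc c)) {a : Fin (suc c)} (avoids : ∀ v → χ v ≢ a) →
  ∀ {u v} → dropColour χ avoids u ≡ dropColour χ avoids v → χ u ≡ χ v
dropColour-reflects χ avoids {u} {v} =
  punchOut-injective (≢-sym (avoids u)) (≢-sym (avoids v))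

avoiding-colour : ClusteringAtLeast G c k → (χ : Colouring G (suc c)) {a : Fin (suc c)} →
  (∀ v → χ v ≢ a) → HasMonoComponent≥ G χ k
avoiding-colour clustering χ avoids =
  component-embed ↪-refl (dropColour-reflects χ avoids) (clustering (dropColour χ avoids))

avoiding-two-colours : ClusteringAtLeast G c k → (χ : Colouring G (suc (suc c)))
  {a b : Fin (suc (suc c))} → a ≢ b → (∀ v → χ v ≢ a) → (∀ v → χ v ≢ b) →
  HasMonoComponent≥ G χ k
avoiding-two-colours clustering χ a≢b avoids-a avoids-b =
  component-embed ↪-refl (dropColour-reflects χ avoids-a)
    (avoiding-colour clustering (dropColour χ avoids-a)
      λ v e → avoids-b v (punchOut-injective (≢-sym (avoids-a v)) a≢b e))

⊠-adj : ∀ {u u' s s'} → Adj G u u' → s ≡ s' ⊎ Adj L s s' → Adj (G ⊠ L) (u , s) (u' , s')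
⊠-adj u~u' (inj₁ refl) = inj₂ (inj₁ (refl , u~u'))
⊠-adj u~u' (inj₂ s~s') = inj₂ (inj₂ (u~u' , s~s'))

layer : V L → G ↪ G ⊠ L
layer {L = L} {G = G} s = record
  { embed = λ u → u , s
  ; embed-adj = λ u~u' → ⊠-adj {G = G} {L = L} u~u' (inj₁ refl)
  ; embed-injective = ,-injectiveˡ }

column : V G → L ↪ G ⊠ L
column u = record
  { embed = λ s → u , s
  ; embed-adj = λ s~s' → inj₁ (refl , s~s')
  ; embed-injective = ,-injectiveʳ }

_⊠↪_ : G ↪ G' → (L : Graph) → G ⊠ L ↪ G' ⊠ L
_⊠↪_ {G = G} {G' = G'} e L = record
  { embed = λ (u , s) → embed e u , s
  ; embed-adj = adj
  ; embed-injective = λ eq →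
      cong₂ _,_ (embed-injective e (,-injectiveˡ eq)) (,-injectiveʳ eq) }
  where
  adj : ∀ {u u' s s'} → Adj (G ⊠ L) (u , s) (u' , s') →
    Adj (G' ⊠ L) (embed e u , s) (embed e u' , s')
  adj (inj₁ (refl , s~s')) = inj₁ (refl , s~s')
  adj (inj₂ (inj₁ (refl , u~u'))) = inj₂ (inj₁ (refl , embed-adj e u~u'))
  adj (inj₂ (inj₂ (u~u' , s~s'))) = inj₂ (inj₂ (embed-adj e u~u' , s~s'))

copy : Fin m → G ↪ hat m G
copy i = record
  { embed = λ x → just (i , x)
  ; embed-adj = λ x~y → refl , x~y
  ; embed-injective = ,-injectiveʳ ∘ just-injective }

path-step : (t : Fin m) → Adj (PathGraph (suc m)) (inject₁ t) (suc t)
path-step t = inj₁ (cong suc (toℕ-inject₁ t))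

path-irreflexive : ∀ {s} → ¬ Adj (PathGraph m) s s
path-irreflexive (inj₁ e) = 1+n≢n e
path-irreflexive (inj₂ e) = 1+n≢n e

path-shift : PathGraph m ↪ PathGraph (suc m)
path-shift = record
  { embed = suc
  ; embed-adj = Sum.map (cong suc) (cong suc)
  ; embed-injective = suc-injective }

path-reach : (χ : Colouring (PathGraph (suc m)) c) → (∀ t → χ (inject₁ t) ≡ χ (suc t)) →
  ∀ s → MonoReach (PathGraph (suc m)) χ zero s
path-reach χ _ zero = here
path-reach {m = suc m} χ constant (suc s) =
  step (path-step {m = suc m} zero) (constant zero)
    (reach-embed (path-shift {m = suc m}) id (path-reach (χ ∘ suc) (constant ∘ suc) s))

path-connected-or-bichromatic : (χ : Colouring (PathGraph (suc m)) c) →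
  (∀ s → MonoReach (PathGraph (suc m)) χ zero s) ⊎
  Σ (Fin (suc m)) λ s → Σ (Fin (suc m)) λ s' → Adj (PathGraph (suc m)) s s' × χ s ≢ χ s'
path-connected-or-bichromatic χ
  with all-or-counterexample (λ t → χ (inject₁ t) ≟ χ (suc t))
... | inj₁ constant = inj₁ (path-reach χ constant)
... | inj₂ (t , ≢) = inj₂ (inject₁ t , suc t , path-step t , ≢)

module HatProduct {c K m : ℕ} (H : Graph) (finite : Finite H)
  (clusteringH : ClusteringAtLeast H c (suc K))
  (clusteringH⊠P : ClusteringAtLeast (H ⊠ PathGraph (suc m)) (suc c) (suc K))
  (χ : Colouring (hat K H ⊠ PathGraph (suc m)) (suc (suc c))) where

  Path : Graph
  Path = PathGraph (suc m)

  J : Graph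
  J = hat K H

  J⊠Path : Graph
  J⊠Path = J ⊠ Path

  apex : V Path → V J⊠Path
  apex s = nothing , s

  inCopy : Fin K → V H × V Path → V J⊠Path
  inCopy i = embed (copy {G = H} i ⊠↪ Path)

  apex-adj : ∀ {s r i x} → s ≡ r ⊎ Adj Path s r → Adj J⊠Path (apex s) (inCopy i (x , r))
  apex-adj = ⊠-adj {G = J} {L = Path} tt

  Reached : V J⊠Path → V J⊠Path → Set
  Reached u v = MonoReach J⊠Path χ u v × v ≢ u

  component-of : ∀ u → AtLeast K (Reached u) → HasMonoComponent≥ J⊠Path χ (suc K)
  component-of u vs = mono-component u (atLeast-cons here vs)

  atLeast-per-copy : {R : V J⊠Path → Set} (w : Fin K → V H × V Path) →
    (∀ i → R (inCopy i (w i))) → AtLeast K R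
  atLeast-per-copy w Rw =
    distinct (λ i → inCopy i (w i)) (λ e → ,-injectiveˡ (just-injective (,-injectiveˡ e))) Rw

  copy-has-colour? : (a : Fin (suc (suc c))) (i : Fin K) →
    Dec (∃ λ (w : V H × V Path) → χ (inCopy i w) ≡ a)
  copy-has-colour? a i =
    map′ (λ (x , s , e) → (x , s) , e) (λ ((x , s) , e) → x , s , e)
      (any?-↔ (proj₂ finite) λ x → any? λ s → χ (inCopy i (x , s)) ≟ a)

  monochromatic-column : ∀ {s₀} → (∀ s → MonoReach J⊠Path χ (apex s₀) (apex s)) →
    HasMonoComponent≥ J⊠Path χ (suc K)
  monochromatic-column {s₀} column-reach
    with all-or-counterexample (copy-has-colour? (χ (apex s₀)))
  ... | inj₂ (i , no-a) =
    component-embed (copy i ⊠↪ Path) id (avoiding-colour clusteringH⊠P _ λ w e → no-a (w , e))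
  ... | inj₁ has-a =
    component-of (apex s₀) (atLeast-per-copy (proj₁ ∘ has-a) (reached ∘ proj₂ ∘ has-a))
    where
    reached : ∀ {i x s} → χ (inCopy i (x , s)) ≡ χ (apex s₀) →
      Reached (apex s₀) (inCopy i (x , s))
    reached {s = s} ≡a =
      reach-trans (column-reach s)
        (step (apex-adj (inj₁ refl)) (trans (sym (reach-colour (column-reach s))) (sym ≡a)) here) ,
      λ ()

  module BichromaticEdge {s s' : V Path} (s~s' : Adj Path s s')
    (a≢b : χ (apex s) ≢ χ (apex s')) where

    InAB : V J⊠Path → Set
    InAB v = χ v ≡ χ (apex s) ⊎ χ v ≡ χ (apex s')

    Spoke : V J⊠Path → Set
    Spoke v = Reached (apex s) v ⊎ Reached (apex s') v

    layers-meet-ab : ∀ r →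
      (∀ i → ∃ λ x → InAB (inCopy i (x , r))) ⊎ HasMonoComponent≥ J⊠Path χ (suc K)
    layers-meet-ab r
      with all-or-counterexample (λ i → any?-↔ (proj₂ finite) λ x →
             (χ (inCopy i (x , r)) ≟ χ (apex s)) ⊎-dec (χ (inCopy i (x , r)) ≟ χ (apex s')))
    ... | inj₁ meet = inj₁ meet
    ... | inj₂ (i , ¬meet) =
      inj₂ (component-embed (layer r ∘↪ copy i) id
        (avoiding-two-colours clusteringH _ a≢b
          (λ x e → ¬meet (x , inj₁ e)) (λ x e → ¬meet (x , inj₂ e))))

    spokes : ∀ {r} → s ≡ r ⊎ Adj Path s r → s' ≡ r ⊎ Adj Path s' r →
      (∀ i → ∃ λ x → InAB (inCopy i (x , r))) → AtLeast K (λ v → proj₂ v ≡ r × Spoke v)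
    spokes {r} near near' meet =
      atLeast-per-copy (λ i → proj₁ (meet i) , r) (λ i → refl , spoke (proj₂ (meet i)))
      where
      spoke : ∀ {i x} → InAB (inCopy i (x , r)) → Spoke (inCopy i (x , r))
      spoke (inj₁ ≡a) = inj₁ (step (apex-adj near) (sym ≡a) here , λ ())
      spoke (inj₂ ≡b) = inj₂ (step (apex-adj near') (sym ≡b) here , λ ())

    different-layers : ∀ {v} → proj₂ v ≡ s × Spoke v → ¬ (proj₂ v ≡ s' × Spoke v)
    different-layers (≡s , _) (≡s' , _) =
      path-irreflexive {m = suc m} (subst (Adj Path s) (trans (sym ≡s') ≡s) s~s')

    component : HasMonoComponent≥ J⊠Path χ (suc K)
    component with layers-meet-ab s | layers-meet-ab s'
    ... | inj₂ found | _ = found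
    ... | inj₁ _ | inj₂ found = found
    ... | inj₁ meet | inj₁ meet' =
      [ component-of (apex s) , component-of (apex s') ]′
        (pigeonhole-⊎ K K
          (atLeast-mono [ proj₂ , proj₂ ]′
            (atLeast-⊎ different-layers
              (spokes (inj₁ refl) (inj₂ (swap s~s')) meet)
              (spokes (inj₂ s~s') (inj₁ refl) meet'))))

  component : HasMonoComponent≥ J⊠Path χ (suc K)
  component with path-connected-or-bichromatic (χ ∘ apex)
  ... | inj₁ connected = monochromatic-column (reach-embed (column nothing) id ∘ connected)
  ... | inj₂ (_ , _ , s~s' , a≢b) = BichromaticEdge.component s~s' a≢b

hat⊠path-clustering : (H : Graph) → Finite H → (m : ℕ) →
  ClusteringAtLeast H c (suc k) →
  ClusteringAtLeast (H ⊠ PathGraph m) (suc c) (suc k) →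
  ClusteringAtLeast (hat k H ⊠ PathGraph m) (suc (suc c)) (suc k)
-- H ⊠ PathGraph 0 has no vertices, so the hypothesis on it cannot hold.
hat⊠path-clustering H finite zero _ clusteringH⊠P _ with clusteringH⊠P (λ _ → zero)
... | (_ , ()) , _
hat⊠path-clustering H finite (suc m) clusteringH clusteringH⊠P χ =
  HatProduct.component H finite clusteringH clusteringH⊠P χ

lemma25 : (c k : ℕ) → c ≥ 2 → k ≥ 2 → (H : Graph) → FiniteSimple H → (m : ℕ) →
    ClusteringAtLeast H (c ∸ 1) k →
    ClusteringAtLeast (H ⊠ PathGraph m) c k →
    ClusteringAtLeast (hat (k ∸ 1) H ⊠ PathGraph m) (suc c) k
lemma25 (suc c) (suc k) _ _ H (finite , _) = hat⊠path-clustering H finite
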